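{- Let $G$ be a finite group and $S$ a non-empty inverse-closed subset of $G$ not containing the identity $1$. Let $d_\Gamma$ be the path metric of the Cayley graph $\mathrm{Cay}(G,S)$. Let $C\subseteq G$ be a non-empty subset with $d_\Gamma(c,c')\ge 3$ for all distinct $c,c'\in C$. Let $H$ be a subgroup of $G$, and let $\mathcal{Z}=\{Ha_1,\dots,Ha_m\}$ be the set of right cosets of $H$ in $G$, ordered by $Ha_i<Ha_j$ for $i<j$. Let $\rho=\rho_{\mathcal{Z}}^G$ be the permutation representation defined with respect to this ordering, and set $M=\sum_{s\in S\cup\{1\}}\rho(s)$. Then $|C|$ is at most the optimal value of the integer program $$\text{maximize } \sum_{i=1}^{m}x_i \quad\text{subject to}\quad M(x_1,\dots,x_m)^T\le |H|\,\mathbf{1},\quad x_i\in\mathbb{Z},\ x_i\ge 0\ (1\le i\le m),$$ where $\mathbf{1}$ is the all-ones column vector of length $m$ and the inequality is entrywise.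
   Context: $\mathrm{Cay}(G,S)$ has vertex set $G$, and $g,h$ are adjacent iff $gh^{ -1}\in S$. $d_\Gamma$ is the shortest-path distance in this graph. For the ordered coset set $\mathcal{Z}$, $\rho_{\mathcal{Z}}^G(g)$ is the $m\times m$ $0/1$ matrix whose $(i,j)$ entry is $1$ iff $Ha_ig=Ha_j$. -}

module Defs where

open import Level using (Level; _⊔_)
open import Algebra.Bundles using (Group)
open import Data.Nat using (ℕ; zero; suc; _+_; _*_; _≤_; _<_)
open import Data.Fin using (Fin; zero; suc)
open import Data.Product using (Σ; ∃; _×_; _,_)
open import Relation.Nullary using (¬_; Dec; yes; no)
open import Relation.Binary.PropositionalEquality using (_≡_)

count : ∀ {p} (n : ℕ) (P : Fin n → Set p) → (∀ i → Dec (P i)) → ℕ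
count zero    P d = 0
count (suc n) P d with d zero
... | yes _ = suc (count n (λ i → P (suc i)) (λ i → d (suc i)))
... | no  _ = count n (λ i → P (suc i)) (λ i → d (suc i))

sumFin : (n : ℕ) → (Fin n → ℕ) → ℕ
sumFin zero    f = 0
sumFin (suc n) f = f zero + sumFin n (λ i → f (suc i))

module _ {c ℓ : Level} (G : Group c ℓ) where
  open Group G

  record FiniteEnum (n : ℕ) : Set (c ⊔ ℓ) where
    field
      enum  : Fin n → Carrier
      surj  : ∀ g → ∃ λ k → enum k ≈ g
      inj   : ∀ k l → enum k ≈ enum l → k ≡ l

  Respects : ∀ {p} → (Carrier → Set p) → Set (c ⊔ ℓ ⊔ p)
  Respects P = ∀ {x y} → x ≈ y → P x → P y

  record IsSubgroup {p} (H : Carrier → Set p) : Set (c ⊔ ℓ ⊔ p) where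
    field
      resp   : Respects H
      has-ε  : H ε
      ∙-clos : ∀ {x y} → H x → H y → H (x ∙ y)
      ⁻¹-clos : ∀ {x} → H x → H (x ⁻¹)

  -- Cayley graph Cay(G,S): g ~ h iff g h⁻¹ ∈ S; walks of length k
  data Walk {p} (S : Carrier → Set p) : ℕ → Carrier → Carrier → Set (c ⊔ ℓ ⊔ p) where
    here : ∀ {g h} → g ≈ h → Walk S zero g h
    step : ∀ {k g w h} → S (g ∙ w ⁻¹) → Walk S k w h → Walk S (suc k) g h

  -- d_Γ(g,h) ≥ k  (distance is the least length of a walk; ∞ if none)
  DistGE : ∀ {p} (S : Carrier → Set p) → ℕ → Carrier → Carrier → Set (c ⊔ ℓ ⊔ p)
  DistGE S k g h = ∀ j → j < k → ¬ Walk S j g h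

  record RightTransversal {p} (H : Carrier → Set p) (m : ℕ) : Set (c ⊔ ℓ ⊔ p) where
    field
      rep      : Fin m → Carrier
      covers   : ∀ g → ∃ λ i → H (g ∙ rep i ⁻¹)
      distinct : ∀ i j → H (rep i ∙ rep j ⁻¹) → i ≡ j

  module _ {p} {H : Carrier → Set p} (H? : ∀ x → Dec (H x)) {m : ℕ}
           (Z : RightTransversal H m) where
    open RightTransversal Z

    -- ρ(g)_{ij} = 1 iff H a_i g = H a_j  (i.e. a_i g a_j⁻¹ ∈ H)
    ρ : Carrier → Fin m → Fin m → ℕ
    ρ g i j with H? ((rep i ∙ g) ∙ rep j ⁻¹)
    ... | yes _ = 1
    ... | no  _ = 0

    -- M = Σ_{s ∈ S ∪ {1}} ρ(s), where S is enumerated through the finite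
    -- enumeration of G (1 ∉ S, so S ∪ {1} is a disjoint union)
    Mmat : ∀ {n q} (E : FiniteEnum n) (S : Carrier → Set q) →
           (∀ x → Dec (S x)) → Fin m → Fin m → ℕ
    Mmat {n} E S S? i j =
      ρ ε i j + sumFin n (λ k → sel (S? (FiniteEnum.enum E k)) (ρ (FiniteEnum.enum E k) i j))
      where
        sel : ∀ {r} {A : Set r} → Dec A → ℕ → ℕ
        sel (yes _) v = v
        sel (no _)  v = 0

Feasible : (m : ℕ) → (Fin m → Fin m → ℕ) → ℕ → (Fin m → ℕ) → Set
Feasible m M b x = ∀ i → sumFin m (λ j → M i j * x j) ≤ b

IsOptimalValue : (m : ℕ) → (Fin m → Fin m → ℕ) → ℕ → ℕ → Set
IsOptimalValue m M b v =
  (Σ (Fin m → ℕ) λ x → Feasible m M b x × sumFin m x ≡ v)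
  × (∀ x → Feasible m M b x → sumFin m x ≤ v)

-- Put x_j = |C ∩ a_j⁻¹H|, so that Σ x_j ≥ |C| because the left cosets a_j⁻¹H cover G.
-- Row i of M x is Σ_{s ∈ S ∪ {1}} x_{j(s)}, where H a_i s = H a_{j(s)}; it counts the pairs
-- (s, c) ∈ (S ∪ {1}) × C with a_i s c ∈ H. The element s c lies in the closed ball of radius 1
-- about c, and these balls are disjoint because codewords are at distance at least 3; hence
-- (s, c) ↦ a_i s c is injective and the row is at most |H|.
module Submission where

open import Defs
open import Level using (Level; _⊔_; Lift; lift)
open import Algebra.Bundles using (Group)
open import Data.Nat using (ℕ; zero; suc; _+_; _*_; _≤_; _<_; z≤n; s≤s)
open import Data.Nat.Properties
  using (+-*-semiring; m≤m+n; m≤n+m; n≤0⇒n≡0; ≤-refl; ≤-trans; ≤-reflexive; +-mono-≤; *-monoʳ-≤; +-identityʳ; *-identityˡ; *-assoc; ≮⇒≥; _<?_; module ≤-Reasoning)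
open import Algebra.Properties.Semiring.Sum +-*-semiring
  using (sum; sum-syntax; sum-cong-≗; ∑-comm; *-distribˡ-sum; *-distribʳ-sum)
open import Data.Fin using (Fin; zero; suc; _≟_)
open import Data.Fin.Properties using (0≢1+n; suc-injective)
open import Data.Vec.Functional using (tail)
open import Function using (_∘_)
open import Data.Product using (∃; _×_; _,_; proj₁; proj₂; uncurry)
open import Data.Sum using (_⊎_; inj₁; inj₂)
open import Data.Unit using (⊤; tt)
open import Data.Empty using (⊥-elim)
open import Relation.Nullary using (¬_; Dec; yes; no; _×-dec_)
open import Relation.Binary.PropositionalEquality as ≡ using (_≡_; refl; cong; cong₂; subst)

𝟙 : ∀ {a} {A : Set a} → Dec A → ℕ
𝟙 (yes _) = 1
𝟙 (no _)  = 0

module _ {a b} {A : Set a} {B : Set b} where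

  𝟙-mono : (A → B) → (a? : Dec A) (b? : Dec B) → 𝟙 a? ≤ 𝟙 b?
  𝟙-mono f (yes x) (yes _) = ≤-refl
  𝟙-mono f (yes x) (no ¬y) = ⊥-elim (¬y (f x))
  𝟙-mono f (no _)  _       = z≤n

  𝟙-×-dec : (a? : Dec A) (b? : Dec B) → 𝟙 (a? ×-dec b?) ≡ 𝟙 a? * 𝟙 b?
  𝟙-×-dec (yes _) (yes _) = refl
  𝟙-×-dec (yes _) (no _)  = refl
  𝟙-×-dec (no _)  _       = refl

𝟙>0⇒ : ∀ {a} {A : Set a} (a? : Dec A) → 0 < 𝟙 a? → A
𝟙>0⇒ (yes x) _ = x

sumFin≡sum : ∀ n (f : Fin n → ℕ) → sumFin n f ≡ sum f
sumFin≡sum zero    f = refl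
sumFin≡sum (suc n) f = cong (f zero +_) (sumFin≡sum n (tail f))

count≡∑𝟙 : ∀ {p} n {P : Fin n → Set p} (P? : ∀ i → Dec (P i)) →
           count n P P? ≡ ∑[ i < n ] 𝟙 (P? i)
count≡∑𝟙 zero    P? = refl
count≡∑𝟙 (suc n) P? with P? zero
... | yes _ = cong suc (count≡∑𝟙 n (λ i → P? (suc i)))
... | no _  = count≡∑𝟙 n (λ i → P? (suc i))

𝟙*∑𝟙 : ∀ {a b} {A : Set a} {n} {B : Fin n → Set b} (a? : Dec A) (b? : ∀ l → Dec (B l)) →
        𝟙 a? * ∑[ l < n ] 𝟙 (b? l) ≡ ∑[ l < n ] 𝟙 (a? ×-dec b? l)
𝟙*∑𝟙 a? b? = ≡.trans (*-distribˡ-sum (𝟙 a?) (λ l → 𝟙 (b? l))) (sum-cong-≗ (λ l → ≡.sym (𝟙-×-dec a? (b? l))))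

matVec-linear : ∀ {s m} (α : Fin s → ℕ) (B : Fin s → Fin m → ℕ) (x : Fin m → ℕ) →
                ∑[ j < m ] ((∑[ t < s ] (α t * B t j)) * x j) ≡ ∑[ t < s ] (α t * ∑[ j < m ] (B t j * x j))
matVec-linear {s} {m} α B x = begin
  ∑[ j < m ] ((∑[ t < s ] (α t * B t j)) * x j)
    ≡⟨ sum-cong-≗ (λ j → *-distribʳ-sum (x j) (λ t → α t * B t j)) ⟩
  ∑[ j < m ] ∑[ t < s ] (α t * B t j * x j)
    ≡⟨ ∑-comm (λ j t → α t * B t j * x j) ⟩
  ∑[ t < s ] ∑[ j < m ] (α t * B t j * x j)
    ≡⟨ sum-cong-≗ (λ t → ≡.trans (sum-cong-≗ (λ j → *-assoc (α t) (B t j) (x j)))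
                                 (≡.sym (*-distribˡ-sum (α t) (λ j → B t j * x j)))) ⟩
  ∑[ t < s ] (α t * ∑[ j < m ] (B t j * x j)) ∎
  where open ≡.≡-Reasoning

AtMostOnePositive : ∀ {a} {A : Set a} → (A → ℕ) → Set a
AtMostOnePositive f = ∀ {x y} → 0 < f x → 0 < f y → x ≡ y

InjectiveOnSupport : ∀ {a b} {A : Set a} {B : Set b} → (A → ℕ) → (A → B) → Set (a ⊔ b)
InjectiveOnSupport w f = ∀ {x y} → 0 < w x → 0 < w y → f x ≡ f y → x ≡ y

sum-mono-≤ : ∀ {n} {f g : Fin n → ℕ} → (∀ i → f i ≤ g i) → sum f ≤ sum g
sum-mono-≤ {zero}  f≤g = z≤n
sum-mono-≤ {suc n} f≤g = +-mono-≤ (f≤g zero) (sum-mono-≤ (f≤g ∘ suc))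

term≤sum : ∀ {n} (f : Fin n → ℕ) i → f i ≤ sum f
term≤sum f zero    = m≤m+n (f zero) _
term≤sum f (suc i) = ≤-trans (term≤sum (tail f) i) (m≤n+m _ (f zero))

sum>0⇒term>0 : ∀ {n} (f : Fin n → ℕ) → 0 < sum f → ∃ λ i → 0 < f i
sum>0⇒term>0 {suc n} f ∑f>0 with 0 <? f zero
... | yes f₀>0 = zero , f₀>0
... | no  f₀≯0 with sum>0⇒term>0 (tail f) (subst (λ v → 0 < v + sum (tail f)) (n≤0⇒n≡0 (≮⇒≥ f₀≯0)) ∑f>0)
...   | i , fᵢ>0 = suc i , fᵢ>0

atMostOnePositive-tail : ∀ {n} {f : Fin (suc n) → ℕ} → AtMostOnePositive f → AtMostOnePositive (tail f)
atMostOnePositive-tail unique p q = suc-injective (unique p q)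

sum≤-atMostOnePositive : ∀ {n} (f : Fin n → ℕ) {b} → AtMostOnePositive f →
                         (∀ i → f i ≤ b) → sum f ≤ b
sum≤-atMostOnePositive {zero}  f unique f≤b = z≤n
sum≤-atMostOnePositive {suc n} f {b} unique f≤b with 0 <? f zero
... | no f₀≯0 =
  +-mono-≤ (≮⇒≥ f₀≯0) (sum≤-atMostOnePositive (tail f) (atMostOnePositive-tail unique) (f≤b ∘ suc))
... | yes f₀>0 = ≤-trans (+-mono-≤ (f≤b zero) ∑tail≤0) (≤-reflexive (+-identityʳ b))
  where
    tail≤0 : ∀ i → f (suc i) ≤ 0
    tail≤0 i = ≮⇒≥ (λ fᵢ>0 → 0≢1+n (unique f₀>0 fᵢ>0))
    ∑tail≤0 : sum (tail f) ≤ 0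
    ∑tail≤0 = sum≤-atMostOnePositive (tail f) (atMostOnePositive-tail unique) tail≤0

∑∑≤-atMostOnePositive : ∀ {a b} (w : Fin a → Fin b → ℕ) {B} → AtMostOnePositive (uncurry w) →
                        (∀ t l → w t l ≤ B) → ∑[ t < a ] ∑[ l < b ] w t l ≤ B
∑∑≤-atMostOnePositive w unique w≤B =
  sum≤-atMostOnePositive (λ t → sum (w t)) outer
    (λ t → sum≤-atMostOnePositive (w t) (λ p q → cong proj₂ (unique p q)) (w≤B t))
  where
    outer : AtMostOnePositive (λ t → sum (w t))
    outer p q with sum>0⇒term>0 (w _) p | sum>0⇒term>0 (w _) q
    ... | _ , p′ | _ , q′ = cong proj₁ (unique p′ q′)

x≤𝟙*x : ∀ {a} {A : Set a} (a? : Dec A) {x} → A → x ≤ 𝟙 a? * x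
x≤𝟙*x (yes _) {x} _ = ≤-reflexive (≡.sym (+-identityʳ x))
x≤𝟙*x (no ¬a)     a = ⊥-elim (¬a a)

𝟙*>0⇒ : ∀ {a} {A : Set a} (a? : Dec A) {x} → 0 < 𝟙 a? * x → A × 0 < x
𝟙*>0⇒ (yes a) {x} p = a , subst (0 <_) (+-identityʳ x) p

∑∑≤-injective : ∀ {a b c} (w : Fin a → Fin b → ℕ) (u : Fin c → ℕ) (f : Fin a → Fin b → Fin c) →
                InjectiveOnSupport (uncurry w) (uncurry f) → (∀ t l → w t l ≤ u (f t l)) →
                ∑[ t < a ] ∑[ l < b ] w t l ≤ ∑[ h < c ] u h
∑∑≤-injective {a} {b} {c} w u f f-inj w≤uf = begin
  ∑[ t < a ] ∑[ l < b ] w t l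
    ≤⟨ sum-mono-≤ (λ t → sum-mono-≤ (λ l → spread t l)) ⟩
  ∑[ t < a ] ∑[ l < b ] ∑[ h < c ] fibre t l h
    ≡⟨ sum-cong-≗ (λ t → ∑-comm (fibre t)) ⟩
  ∑[ t < a ] ∑[ h < c ] ∑[ l < b ] fibre t l h
    ≡⟨ ∑-comm (λ t h → ∑[ l < b ] fibre t l h) ⟩
  ∑[ h < c ] ∑[ t < a ] ∑[ l < b ] fibre t l h
    ≤⟨ sum-mono-≤ (λ h → ∑∑≤-atMostOnePositive (λ t l → fibre t l h) (unique h) (fibre≤u h)) ⟩
  ∑[ h < c ] u h ∎
  where
    open ≤-Reasoning
    fibre : Fin a → Fin b → Fin c → ℕ
    fibre t l h = 𝟙 (f t l ≟ h) * w t l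

    spread : ∀ t l → w t l ≤ ∑[ h < c ] fibre t l h
    spread t l = ≤-trans (x≤𝟙*x (f t l ≟ f t l) refl) (term≤sum (fibre t l) (f t l))

    fibre≤u : ∀ h t l → fibre t l h ≤ u h
    fibre≤u h t l with f t l ≟ h
    ... | yes refl = ≤-trans (≤-reflexive (+-identityʳ (w t l))) (w≤uf t l)
    ... | no _     = z≤n

    unique : ∀ h → AtMostOnePositive (uncurry (λ t l → fibre t l h))
    unique h {t , l} {t′ , l′} p q with 𝟙*>0⇒ (f t l ≟ h) p | 𝟙*>0⇒ (f t′ l′ ≟ h) q
    ... | ftl≡h , w>0 | ft′l′≡h , w′>0 = f-inj w>0 w′>0 (≡.trans ftl≡h (≡.sym ft′l′≡h))

module CosetArithmetic {c ℓ r} (G : Group c ℓ) {H : Group.Carrier G → Set r}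
                       (H-sub : IsSubgroup G H) where
  open Group G
  open IsSubgroup H-sub
  open import Algebra.Properties.Group G using (\\-leftDividesʳ; ⁻¹-anti-homo-//; ⁻¹-involutive)

  H-//-∙ : ∀ {x y z} → H (x // y) → H (y ∙ z) → H (x ∙ z)
  H-//-∙ {x} {y} {z} p q = resp x/y∙yz≈xz (∙-clos p q)
    where
      x/y∙yz≈xz : (x // y) ∙ (y ∙ z) ≈ x ∙ z
      x/y∙yz≈xz = trans (assoc x (y ⁻¹) (y ∙ z)) (∙-congˡ (\\-leftDividesʳ y z))

  H-//-shared : ∀ {x y z} → H (x // y) → H (x // z) → H (y // z)
  H-//-shared p q = H-//-∙ (resp (⁻¹-anti-homo-// _ _) (⁻¹-clos p)) q

  H-⁻¹//⇒∙ : ∀ {x y} → H (x ⁻¹ // y) → H (y ∙ x)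
  H-⁻¹//⇒∙ {x} {y} p = resp (trans (⁻¹-anti-homo-// (x ⁻¹) y) (∙-congˡ (⁻¹-involutive x))) (⁻¹-clos p)

module CayleyWalks {c ℓ p} (G : Group c ℓ) {S : Group.Carrier G → Set p}
                   (S-resp : Respects G S) (S-inv : ∀ {s} → S s → S (Group._⁻¹ G s)) where
  open Group G renaming (refl to ≈-refl)
  open import Algebra.Properties.Group G using (\\-leftDividesˡ; //-rightDividesʳ; ⁻¹-anti-homo-∙)

  S⁺ : Carrier → Set (ℓ ⊔ p)
  S⁺ s = s ≈ ε ⊎ S s

  walk-respˡ : ∀ {k g g′ h} → g ≈ g′ → Walk G S k g′ h → Walk G S k g h
  walk-respˡ g≈g′ (here g′≈h) = here (trans g≈g′ g′≈h)
  walk-respˡ g≈g′ (step s w)  = step (S-resp (∙-congʳ (sym g≈g′)) s) w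

  walk-++ : ∀ {j k g h l} → Walk G S j g h → Walk G S k h l → Walk G S (j + k) g l
  walk-++ (here g≈h) w′ = walk-respˡ g≈h w′
  walk-++ (step s w) w′ = step s (walk-++ w w′)

  walk-into-S⁺-translate : ∀ {s} g → S⁺ s → ∃ λ j → j ≤ 1 × Walk G S j g (s ∙ g)
  walk-into-S⁺-translate g (inj₁ s≈ε) = 0 , z≤n , here (sym (trans (∙-congʳ s≈ε) (identityˡ g)))
  walk-into-S⁺-translate {s} g (inj₂ s∈S) =
    1 , ≤-refl , step (S-resp (sym g/sg≈s⁻¹) (S-inv s∈S)) (here ≈-refl)
    where
      g/sg≈s⁻¹ : g // (s ∙ g) ≈ s ⁻¹
      g/sg≈s⁻¹ = trans (∙-congˡ (⁻¹-anti-homo-∙ s g)) (\\-leftDividesˡ g (s ⁻¹))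

  walk-from-S⁺-translate : ∀ {s} g → S⁺ s → ∃ λ j → j ≤ 1 × Walk G S j (s ∙ g) g
  walk-from-S⁺-translate g (inj₁ s≈ε) = 0 , z≤n , here (trans (∙-congʳ s≈ε) (identityˡ g))
  walk-from-S⁺-translate {s} g (inj₂ s∈S) =
    1 , ≤-refl , step (S-resp (sym (//-rightDividesʳ g s)) s∈S) (here ≈-refl)

  -- s ∙ x with s ∈ S⁺ ranges over the closed ball of radius 1 about x.
  S⁺-translates-disjoint : ∀ {x y s s′} → DistGE G S 3 x y → S⁺ s → S⁺ s′ → ¬ (s ∙ x ≈ s′ ∙ y)
  S⁺-translates-disjoint {x} {y} dist s⁺ s′⁺ sx≈s′y
    with walk-into-S⁺-translate x s⁺ | walk-from-S⁺-translate y s′⁺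
  ... | j , j≤1 , x→sx | k , k≤1 , s′y→y =
    dist (j + k) (s≤s (+-mono-≤ j≤1 k≤1)) (walk-++ x→sx (walk-++ (here sx≈s′y) s′y→y))

module CoveringBound
  {c ℓ p q r : Level} (G : Group c ℓ) {n : ℕ} (E : FiniteEnum G n)
  {S : Group.Carrier G → Set p} (S? : ∀ x → Dec (S x)) (S-resp : Respects G S)
  (S-inv : ∀ {s} → S s → S (Group._⁻¹ G s)) (ε∉S : ¬ S (Group.ε G))
  {C : Group.Carrier G → Set q} (C? : ∀ x → Dec (C x))
  (C-code : ∀ x y → C x → C y → ¬ Group._≈_ G x y → DistGE G S 3 x y)
  {H : Group.Carrier G → Set r} (H? : ∀ x → Dec (H x)) (H-sub : IsSubgroup G H)
  {m : ℕ} (Z : RightTransversal G H m)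
  where

  open Group G renaming (refl to ≈-refl)
  open import Algebra.Properties.Group G using (∙-cancelˡ; ∙-cancelʳ)
  open FiniteEnum E renaming (enum to e)
  open RightTransversal Z renaming (rep to a)
  open IsSubgroup H-sub
  open CosetArithmetic G H-sub
  open CayleyWalks G S-resp S-inv

  ρᶻ : Carrier → Fin m → Fin m → ℕ
  ρᶻ = ρ G H? Z

  ρᶻ≡𝟙 : ∀ g i j → ρᶻ g i j ≡ 𝟙 (H? ((a i ∙ g) // a j))
  ρᶻ≡𝟙 g i j with H? ((a i ∙ g) // a j)
  ... | yes _ = refl
  ... | no _  = refl

  index : Carrier → Fin n
  index g = proj₁ (surj g)

  e∘index : ∀ g → e (index g) ≈ g
  e∘index g = proj₂ (surj g)

  -- Index 0 stands for the identity and index k+1 for the k-th element of G, so that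
  -- Gen⁺ enumerates S ∪ {1} as the matrix M does.
  gen⁺ : Fin (suc n) → Carrier
  gen⁺ zero    = ε
  gen⁺ (suc k) = e k

  Gen⁺ : Fin (suc n) → Set p
  Gen⁺ zero    = Lift p ⊤
  Gen⁺ (suc k) = S (e k)

  Gen⁺? : ∀ t → Dec (Gen⁺ t)
  Gen⁺? zero    = yes (lift tt)
  Gen⁺? (suc k) = S? (e k)

  Gen⁺⇒S⁺ : ∀ t → Gen⁺ t → S⁺ (gen⁺ t)
  Gen⁺⇒S⁺ zero    _   = inj₁ ≈-refl
  Gen⁺⇒S⁺ (suc k) s∈S = inj₂ s∈S

  gen⁺-injective : ∀ {t t′} → Gen⁺ t → Gen⁺ t′ → gen⁺ t ≈ gen⁺ t′ → t ≡ t′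
  gen⁺-injective {zero}  {zero}   _   _    _  = refl
  gen⁺-injective {zero}  {suc k′} _   s′∈S eq = ⊥-elim (ε∉S (S-resp (sym eq) s′∈S))
  gen⁺-injective {suc k} {zero}   s∈S _    eq = ⊥-elim (ε∉S (S-resp eq s∈S))
  gen⁺-injective {suc k} {suc k′} _   _    eq = cong suc (inj k k′ eq)

  mutual
    Mmat-entry : ∀ i j → Mmat G H? Z E S S? i j ≡ ∑[ t < suc n ] (𝟙 (Gen⁺? t) * ρᶻ (gen⁺ t) i j)
    Mmat-entry i j =
      cong₂ _+_ (≡.sym (*-identityˡ (ρᶻ ε i j))) (≡.trans (sumFin≡sum n _) (sum-cong-≗ (selected i j)))

    -- The left-hand side is the summand of Mmat; its selector is local to Mmat and cannot be named,
    -- so it is left to unification with the use above.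
    selected : ∀ i j k → _ ≡ 𝟙 (S? (e k)) * ρᶻ (e k) i j
    selected i j k with S? (e k)
    ... | yes _ = ≡.sym (+-identityʳ _)
    ... | no _  = refl

  -- x_j counts the codewords c with c ∈ a_j⁻¹H, i.e. c⁻¹ ∈ H a_j.
  codeCount : Fin m → ℕ
  codeCount j = ∑[ l < n ] 𝟙 (C? (e l) ×-dec H? (a j ∙ e l))

  shiftedCodeCount : Fin m → Carrier → ℕ
  shiftedCodeCount i g = ∑[ l < n ] 𝟙 (C? (e l) ×-dec H? ((a i ∙ g) ∙ e l))

  |C|≤∑codeCount : count n (λ l → C (e l)) (λ l → C? (e l)) ≤ sumFin m codeCount
  |C|≤∑codeCount = begin
    count n (λ l → C (e l)) (λ l → C? (e l)) ≡⟨ count≡∑𝟙 n (λ l → C? (e l)) ⟩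
    ∑[ l < n ] 𝟙 (C? (e l))                   ≤⟨ sum-mono-≤ inSomeCoset ⟩
    ∑[ l < n ] ∑[ j < m ] 𝟙 (C? (e l) ×-dec H? (a j ∙ e l))
      ≡⟨ ∑-comm (λ l j → 𝟙 (C? (e l) ×-dec H? (a j ∙ e l))) ⟩
    ∑[ j < m ] codeCount j                    ≡⟨ ≡.sym (sumFin≡sum m codeCount) ⟩
    sumFin m codeCount ∎
    where
      open ≤-Reasoning
      inSomeCoset : ∀ l → 𝟙 (C? (e l)) ≤ ∑[ j < m ] 𝟙 (C? (e l) ×-dec H? (a j ∙ e l))
      inSomeCoset l with covers (e l ⁻¹)
      ... | j , c⁻¹∈Haⱼ = ≤-trans (𝟙-mono (λ c∈C → c∈C , H-⁻¹//⇒∙ c⁻¹∈Haⱼ) (C? (e l)) _) (term≤sum _ j)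

  ρ-row≤shiftedCodeCount : ∀ i g → ∑[ j < m ] (ρᶻ g i j * codeCount j) ≤ shiftedCodeCount i g
  ρ-row≤shiftedCodeCount i g = begin
    ∑[ j < m ] (ρᶻ g i j * codeCount j)
      ≡⟨ sum-cong-≗ (λ j → ≡.trans (cong (_* codeCount j) (ρᶻ≡𝟙 g i j))
                                    (𝟙*∑𝟙 (H? ((a i ∙ g) // a j)) (λ l → C? (e l) ×-dec H? (a j ∙ e l)))) ⟩
    ∑[ j < m ] ∑[ l < n ] term l j ≡⟨ ∑-comm (λ j l → term l j) ⟩
    ∑[ l < n ] ∑[ j < m ] term l j ≤⟨ sum-mono-≤ (λ l → sum≤-atMostOnePositive (term l) unique (term≤ l)) ⟩
    shiftedCodeCount i g ∎
    where
      open ≤-Reasoning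
      term : Fin n → Fin m → ℕ
      term l j = 𝟙 (H? ((a i ∙ g) // a j) ×-dec (C? (e l) ×-dec H? (a j ∙ e l)))

      term≤ : ∀ l j → term l j ≤ 𝟙 (C? (e l) ×-dec H? ((a i ∙ g) ∙ e l))
      term≤ l j = 𝟙-mono (λ (aᵢg∈Haⱼ , c∈C , aⱼc∈H) → c∈C , H-//-∙ aᵢg∈Haⱼ aⱼc∈H) _ _

      -- H a_i g is a single right coset, so at most one a_j lies in it.
      unique : ∀ {l} → AtMostOnePositive (term l)
      unique {l} {j} {j′} p q = distinct j j′ (H-//-shared (proj₁ (𝟙>0⇒ _ p)) (proj₁ (𝟙>0⇒ _ q)))

  translate-injective : ∀ {t t′ l l′} → Gen⁺ t → Gen⁺ t′ → C (e l) → C (e l′) →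
                        gen⁺ t ∙ e l ≈ gen⁺ t′ ∙ e l′ → (t , l) ≡ (t′ , l′)
  translate-injective {t} {t′} {l} {l′} t∈S⁺ t′∈S⁺ c∈C c′∈C eq with l ≟ l′
  ... | yes refl = cong (_, l) (gen⁺-injective t∈S⁺ t′∈S⁺ (∙-cancelʳ (e l) _ _ eq))
  ... | no l≢l′  = ⊥-elim (S⁺-translates-disjoint (C-code _ _ c∈C c′∈C (l≢l′ ∘ inj l l′))
                                                  (Gen⁺⇒S⁺ t t∈S⁺) (Gen⁺⇒S⁺ t′ t′∈S⁺) eq)

  -- The pairs (s, c) ∈ (S ∪ {1}) × C with a_i s c ∈ H inject into H via (s, c) ↦ a_i s c.
  ∑S⁺-shiftedCodeCount≤|H| : ∀ i →
    ∑[ t < suc n ] (𝟙 (Gen⁺? t) * shiftedCodeCount i (gen⁺ t)) ≤ ∑[ h < n ] 𝟙 (H? (e h))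
  ∑S⁺-shiftedCodeCount≤|H| i = begin
    ∑[ t < suc n ] (𝟙 (Gen⁺? t) * shiftedCodeCount i (gen⁺ t))
      ≡⟨ sum-cong-≗ (λ t → 𝟙*∑𝟙 (Gen⁺? t) (λ l → C? (e l) ×-dec H? (y t l))) ⟩
    ∑[ t < suc n ] ∑[ l < n ] w t l
      ≤⟨ ∑∑≤-injective w (λ h → 𝟙 (H? (e h))) (λ t l → index (y t l)) injective w≤ ⟩
    ∑[ h < n ] 𝟙 (H? (e h)) ∎
    where
      open ≤-Reasoning
      y : Fin (suc n) → Fin n → Carrier
      y t l = (a i ∙ gen⁺ t) ∙ e l

      w : Fin (suc n) → Fin n → ℕ
      w t l = 𝟙 (Gen⁺? t ×-dec (C? (e l) ×-dec H? (y t l)))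

      w≤ : ∀ t l → w t l ≤ 𝟙 (H? (e (index (y t l))))
      w≤ t l = 𝟙-mono (λ (_ , _ , y∈H) → resp (sym (e∘index (y t l))) y∈H) _ _

      injective : InjectiveOnSupport (uncurry w) (uncurry (λ t l → index (y t l)))
      injective {t , l} {t′ , l′} p q same-index
        with 𝟙>0⇒ (Gen⁺? t ×-dec _) p | 𝟙>0⇒ (Gen⁺? t′ ×-dec _) q
      ... | t∈S⁺ , c∈C , _ | t′∈S⁺ , c′∈C , _ =
        translate-injective t∈S⁺ t′∈S⁺ c∈C c′∈C (∙-cancelˡ (a i) _ _ aᵢ∙translates)
        where
          y≈y′ : y t l ≈ y t′ l′
          y≈y′ = trans (sym (e∘index (y t l)))
                       (subst (λ k → e k ≈ y t′ l′) (≡.sym same-index) (e∘index (y t′ l′)))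
          aᵢ∙translates : a i ∙ (gen⁺ t ∙ e l) ≈ a i ∙ (gen⁺ t′ ∙ e l′)
          aᵢ∙translates = trans (sym (assoc _ _ _)) (trans y≈y′ (assoc _ _ _))

  codeCount-feasible : Feasible m (Mmat G H? Z E S S?) (count n (λ h → H (e h)) (λ h → H? (e h))) codeCount
  codeCount-feasible i = begin
    sumFin m (λ j → Mmat G H? Z E S S? i j * codeCount j)
      ≡⟨ sumFin≡sum m _ ⟩
    ∑[ j < m ] (Mmat G H? Z E S S? i j * codeCount j)
      ≡⟨ sum-cong-≗ (λ j → cong (_* codeCount j) (Mmat-entry i j)) ⟩
    ∑[ j < m ] ((∑[ t < suc n ] (𝟙 (Gen⁺? t) * ρᶻ (gen⁺ t) i j)) * codeCount j)
      ≡⟨ matVec-linear (λ t → 𝟙 (Gen⁺? t)) (λ t → ρᶻ (gen⁺ t) i) codeCount ⟩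
    ∑[ t < suc n ] (𝟙 (Gen⁺? t) * ∑[ j < m ] (ρᶻ (gen⁺ t) i j * codeCount j))
      ≤⟨ sum-mono-≤ (λ t → *-monoʳ-≤ (𝟙 (Gen⁺? t)) (ρ-row≤shiftedCodeCount i (gen⁺ t))) ⟩
    ∑[ t < suc n ] (𝟙 (Gen⁺? t) * shiftedCodeCount i (gen⁺ t))
      ≤⟨ ∑S⁺-shiftedCodeCount≤|H| i ⟩
    ∑[ h < n ] 𝟙 (H? (e h))
      ≡⟨ ≡.sym (count≡∑𝟙 n (λ h → H? (e h))) ⟩
    count n (λ h → H (e h)) (λ h → H? (e h)) ∎
    where open ≤-Reasoning

mainTheorem6 : ∀ {c ℓ p q r : Level} (G : Group c ℓ) (n : ℕ) (E : FiniteEnum G n)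
    (S : Group.Carrier G → Set p) (S? : ∀ x → Dec (S x)) → Respects G S →
    (∃ λ s → S s) → (∀ {s} → S s → S (Group._⁻¹ G s)) → ¬ S (Group.ε G) →
    (C : Group.Carrier G → Set q) (C? : ∀ x → Dec (C x)) → Respects G C →
    (∃ λ c → C c) →
    (∀ x y → C x → C y → ¬ Group._≈_ G x y → DistGE G S 3 x y) →
    (H : Group.Carrier G → Set r) (H? : ∀ x → Dec (H x)) → IsSubgroup G H →
    (m : ℕ) (Z : RightTransversal G H m) →
    (v : ℕ) → IsOptimalValue m (Mmat G H? Z E S S?) (count n (λ k → H (FiniteEnum.enum E k)) (λ k → H? (FiniteEnum.enum E k))) v →
    count n (λ k → C (FiniteEnum.enum E k)) (λ k → C? (FiniteEnum.enum E k)) ≤ v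
mainTheorem6 G n E S S? S-resp _ S-inv ε∉S C C? _ _ C-code H H? H-sub m Z v (_ , v-maximal) =
  ≤-trans |C|≤∑codeCount (v-maximal codeCount codeCount-feasible)
  where open CoveringBound G E S? S-resp S-inv ε∉S C? C-code H? H-sub Z
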